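{- Let $k\ge1$, $n\ge1$, let $f:\mathfrak T^n\to\mathbb R$ be $k$-submodular with $f(\mathbf 0)=0$, and let $x\in P(f)$. Then the set $\mathfrak F(x)$ is closed under $\sqcap$ and $\sqcup$, and the function $\overline x|_{\mathfrak F(x)}=f|_{\mathfrak F(x)}$ is $k$-modular, i.e. $f(T\sqcap U)+f(T\sqcup U)=f(T)+f(U)$ for all $T,U\in\mathfrak F(x)$.
   Context: $\mathfrak T$ is a set consisting of a root $\mathbf o$ and a set $\mathfrak L$ of exactly $k$ leaves. Binary operations $\sqcap,\sqcup$ on $\mathfrak T$: $t\sqcap t=t\sqcup t=t$; for distinct leaves $a,b$: $a\sqcap b=a\sqcup b=\mathbf o$; for a leaf $a$: $a\sqcap\mathbf o=\mathbf o\sqcap a=\mathbf o$, $a\sqcup\mathbf o=\mathbf o\sqcup a=a$; they act componentwise on $\mathfrak T^n$; $\mathbf 0=(\mathbf o,\dots,\mathbf o)$. $f$ is $k$-submodular if $f(T\sqcap U)+f(T\sqcup U)\le f(T)+f(U)$ for all $T,U$. For $x\in\mathbb R^{n\times\mathfrak L}$, $\overline x(T)=\sum_{i=1}^n\overline x_i(T_i)$ with $\overline x_i(\mathbf o)=0$, $\overline x_i(\ell)=x_{i\ell}$. $P(f)=\{x\in\mathbb R^{n\times\mathfrak L}:\overline x(T)\le f(T)\ \forall T\in\mathfrak T^n,\ \text{and } x_{i\ell}+x_{ip}\le0\ \forall i,\ \forall\text{ distinct }\ell,p\in\mathfrak L\}$. For $x\in P(f)$, $\mathfrak F(x)=\{T\in\mathfrak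 T^n:\overline x(T)=f(T)\}$. -}

module Defs where

open import Data.Nat using (ℕ; zero; suc)
open import Data.Fin using (Fin; zero; suc; _≟_)
open import Relation.Binary.PropositionalEquality using (_≡_; _≢_)
open import Relation.Nullary using (yes; no)
import Data.Sum
import Data.Product

-- The codomain ℝ is abstracted as a totally ordered abelian group
-- (ℝ with + and ≤ is an instance; only this structure is used).
record OrderedAbelianGroup : Set₁ where
  infixl 6 _+_
  infix 4 _≤_
  field
    Carrier     : Set
    _+_         : Carrier → Carrier → Carrier
    0#          : Carrier
    -_          : Carrier → Carrier
    _≤_         : Carrier → Carrier → Set
    +-assoc     : ∀ a b c → (a + b) + c ≡ a + (b + c)
    +-comm      : ∀ a b → a + b ≡ b + a
    +-identityˡ : ∀ a → 0# + a ≡ a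
    -‿inverseˡ  : ∀ a → (- a) + a ≡ 0#
    ≤-refl      : ∀ {a} → a ≤ a
    ≤-trans     : ∀ {a b c} → a ≤ b → b ≤ c → a ≤ c
    ≤-antisym   : ∀ {a b} → a ≤ b → b ≤ a → a ≡ b
    ≤-total     : ∀ a b → (a ≤ b) Data.Sum.⊎ (b ≤ a)
    +-monoˡ-≤   : ∀ {a b} c → a ≤ b → a + c ≤ b + c

data 𝔗 (k : ℕ) : Set where
  o    : 𝔗 k
  leaf : Fin k → 𝔗 k

module _ {k : ℕ} where
  _⊓_ : 𝔗 k → 𝔗 k → 𝔗 k
  o      ⊓ _      = o
  leaf a ⊓ o      = o
  leaf a ⊓ leaf b with a ≟ b
  ... | yes _ = leaf a
  ... | no  _ = o

  _⊔_ : 𝔗 k → 𝔗 k → 𝔗 k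
  o      ⊔ t      = t
  leaf a ⊔ o      = leaf a
  leaf a ⊔ leaf b with a ≟ b
  ... | yes _ = leaf a
  ... | no  _ = o

Tn : ℕ → ℕ → Set
Tn k n = Fin n → 𝔗 k

_⊓ⁿ_ : ∀ {k n} → Tn k n → Tn k n → Tn k n
(T ⊓ⁿ U) i = T i ⊓ U i

_⊔ⁿ_ : ∀ {k n} → Tn k n → Tn k n → Tn k n
(T ⊔ⁿ U) i = T i ⊔ U i

𝟎 : ∀ {k n} → Tn k n
𝟎 _ = o

module OAG (G : OrderedAbelianGroup) where
  open OrderedAbelianGroup G public

  sumFin : (n : ℕ) → (Fin n → Carrier) → Carrier
  sumFin zero    g = 0#
  sumFin (suc n) g = g zero + sumFin n (λ i → g (suc i))

  xbarᵢ : ∀ {k} → (Fin k → Carrier) → 𝔗 k → Carrier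
  xbarᵢ xi o        = 0#
  xbarᵢ xi (leaf ℓ) = xi ℓ

  xbar : ∀ {k n} → (Fin n → Fin k → Carrier) → Tn k n → Carrier
  xbar {k} {n} x T = sumFin n (λ i → xbarᵢ (x i) (T i))

  IsKSubmodular : ∀ {k n} → (Tn k n → Carrier) → Set
  IsKSubmodular f = ∀ T U → f (T ⊓ⁿ U) + f (T ⊔ⁿ U) ≤ f T + f U

  InP : ∀ {k n} → (Tn k n → Carrier) → (Fin n → Fin k → Carrier) → Set
  InP {k} {n} f x =
    (∀ (T : Tn k n) → xbar x T ≤ f T) Data.Product.×
    (∀ (i : Fin n) (ℓ p : Fin k) → ℓ ≢ p → x i ℓ + x i p ≤ 0#)

  In𝔉 : ∀ {k n} → (Tn k n → Carrier) → (Fin n → Fin k → Carrier) → Tn k n → Set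
  In𝔉 f x T = xbar x T ≡ f T

module Submission where

-- For x ∈ P(f) the linear function x̄ is coordinatewise supermodular, since on a
-- coordinate where T and U sit on distinct leaves ℓ, p the constraint x_ℓ + x_p ≤ 0
-- is exactly what is needed. Hence for T, U ∈ 𝔉(x)
--   f T + f U = x̄ T + x̄ U ≤ x̄ (T ⊓ U) + x̄ (T ⊔ U) ≤ f (T ⊓ U) + f (T ⊔ U) ≤ f T + f U,
-- the last step by k-submodularity. So the chain is an equality, which is the
-- k-modularity on 𝔉(x); and because x̄ ≤ f holds termwise, the equality of the sums
-- forces x̄ (T ⊓ U) = f (T ⊓ U) and x̄ (T ⊔ U) = f (T ⊔ U).

open import Defs
open import Algebra.Bundles using (AbelianGroup)
open import Algebra.Consequences.Propositional using (comm∧idˡ⇒id; comm∧invˡ⇒inv)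
import Algebra.Properties.AbelianGroup as AbelianGroupProperties
import Algebra.Properties.CommutativeSemigroup as CommutativeSemigroupProperties
open import Data.Nat using (ℕ; zero; suc)
import Data.Nat as ℕ
open import Data.Fin using (Fin; _≟_)
import Data.Fin as Fin
open import Data.Product using (_×_; _,_; proj₁; proj₂)
open import Level using (0ℓ)
open import Relation.Binary.PropositionalEquality
  using (_≡_; _≢_; refl; sym; trans; cong; cong₂; subst₂; module ≡-Reasoning)
open import Relation.Binary.PropositionalEquality.Algebra using (isMagma)
open import Relation.Nullary using (yes; no)

module OrderedAbelianGroupProperties (G : OrderedAbelianGroup) where
  open OAG G

  abelianGroup : AbelianGroup 0ℓ 0ℓ
  abelianGroup = record
    { isAbelianGroup = record
      { isGroup = record
        { isMonoid = record
          { isSemigroup = record { isMagma = isMagma _+_ ; assoc = +-assoc }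
          ; identity    = comm∧idˡ⇒id +-comm +-identityˡ
          }
        ; inverse = comm∧invˡ⇒inv +-comm -‿inverseˡ
        ; ⁻¹-cong = cong -_
        }
      ; comm = +-comm
      }
    }

  open AbelianGroupProperties abelianGroup public using (∙-cancelʳ)
  open CommutativeSemigroupProperties (AbelianGroup.commutativeSemigroup abelianGroup)
    public using (interchange)

  ≤-reflexive : ∀ {a b} → a ≡ b → a ≤ b
  ≤-reflexive refl = ≤-refl

  +-monoʳ-≤ : ∀ {a b} c → a ≤ b → c + a ≤ c + b
  +-monoʳ-≤ {a} {b} c a≤b = subst₂ _≤_ (+-comm a c) (+-comm b c) (+-monoˡ-≤ c a≤b)

  +-mono-≤ : ∀ {a b c d} → a ≤ b → c ≤ d → a + c ≤ b + d
  +-mono-≤ {b = b} {c = c} a≤b c≤d = ≤-trans (+-monoˡ-≤ c a≤b) (+-monoʳ-≤ b c≤d)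

  ≤∧≤∧+≡+⇒≡ : ∀ {a b c d} → a ≤ b → c ≤ d → a + c ≡ b + d → a ≡ b × c ≡ d
  ≤∧≤∧+≡+⇒≡ {a} {b} {c} {d} a≤b c≤d a+c≡b+d = a≡b , c≡d
    where
    ≤∧+≡+⇒≡ : ∀ {u v w z} → u ≤ v → w ≤ z → u + w ≡ v + z → u ≡ v
    ≤∧+≡+⇒≡ {u} {v} {w} {z} u≤v w≤z u+w≡v+z = ∙-cancelʳ w u v (≤-antisym (+-monoˡ-≤ w u≤v)
      (≤-trans (+-monoʳ-≤ v w≤z) (≤-reflexive (sym u+w≡v+z))))
    a≡b : a ≡ b
    a≡b = ≤∧+≡+⇒≡ a≤b c≤d a+c≡b+d
    c≡d : c ≡ d
    c≡d = ≤∧+≡+⇒≡ c≤d a≤b (trans (+-comm c a) (trans a+c≡b+d (+-comm b d)))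

  sumFin-+ : ∀ n (g h : Fin n → Carrier) →
             sumFin n (λ i → g i + h i) ≡ sumFin n g + sumFin n h
  sumFin-+ zero    g h = sym (+-identityˡ 0#)
  sumFin-+ (suc n) g h = begin
    (g₀ + h₀) + sumFin n (λ i → g (Fin.suc i) + h (Fin.suc i))
      ≡⟨ cong ((g₀ + h₀) +_) (sumFin-+ n (λ i → g (Fin.suc i)) (λ i → h (Fin.suc i))) ⟩
    (g₀ + h₀) + (sumFin n (λ i → g (Fin.suc i)) + sumFin n (λ i → h (Fin.suc i)))
      ≡⟨ interchange g₀ h₀ _ _ ⟩
    sumFin (suc n) g + sumFin (suc n) h ∎
    where
    open ≡-Reasoning
    g₀ h₀ : Carrier
    g₀ = g Fin.zero
    h₀ = h Fin.zero

  sumFin-mono-≤ : ∀ n {g h : Fin n → Carrier} → (∀ i → g i ≤ h i) → sumFin n g ≤ sumFin n h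
  sumFin-mono-≤ zero    g≤h = ≤-refl
  sumFin-mono-≤ (suc n) g≤h = +-mono-≤ (g≤h Fin.zero) (sumFin-mono-≤ n (λ i → g≤h (Fin.suc i)))

module FaceProperties (G : OrderedAbelianGroup) where
  open OAG G
  open OrderedAbelianGroupProperties G

  xbarᵢ-supermodular : ∀ {k} (xᵢ : Fin k → Carrier) → (∀ ℓ p → ℓ ≢ p → xᵢ ℓ + xᵢ p ≤ 0#) →
    ∀ s t → xbarᵢ xᵢ s + xbarᵢ xᵢ t ≤ xbarᵢ xᵢ (s ⊓ t) + xbarᵢ xᵢ (s ⊔ t)
  xbarᵢ-supermodular xᵢ opposite o        t        = ≤-refl
  xbarᵢ-supermodular xᵢ opposite (leaf ℓ) o        = ≤-reflexive (+-comm (xᵢ ℓ) 0#)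
  xbarᵢ-supermodular xᵢ opposite (leaf ℓ) (leaf p) with ℓ ≟ p
  ... | yes refl = ≤-refl
  ... | no  ℓ≢p  = ≤-trans (opposite ℓ p ℓ≢p) (≤-reflexive (sym (+-identityˡ 0#)))

  xbar-supermodular : ∀ {k n} (x : Fin n → Fin k → Carrier) →
    (∀ i ℓ p → ℓ ≢ p → x i ℓ + x i p ≤ 0#) →
    ∀ T U → xbar x T + xbar x U ≤ xbar x (T ⊓ⁿ U) + xbar x (T ⊔ⁿ U)
  xbar-supermodular {n = n} x opposite T U =
    subst₂ _≤_ (sumFin-+ n _ _) (sumFin-+ n _ _)
      (sumFin-mono-≤ n (λ i → xbarᵢ-supermodular (x i) (opposite i) (T i) (U i)))

  𝔉-closed-∧-modular : ∀ {k n} (f : Tn k n → Carrier) → IsKSubmodular f →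
    (x : Fin n → Fin k → Carrier) → InP f x →
    ∀ T U → In𝔉 f x T → In𝔉 f x U →
    (In𝔉 f x (T ⊓ⁿ U) × In𝔉 f x (T ⊔ⁿ U)) × f (T ⊓ⁿ U) + f (T ⊔ⁿ U) ≡ f T + f U
  𝔉-closed-∧-modular f submodular x (x̄≤f , opposite) T U T∈𝔉 U∈𝔉 =
    ≤∧≤∧+≡+⇒≡ (x̄≤f (T ⊓ⁿ U)) (x̄≤f (T ⊔ⁿ U)) x̄≡f , f-modular
    where
    fT+fU≤x̄ : f T + f U ≤ xbar x (T ⊓ⁿ U) + xbar x (T ⊔ⁿ U)
    fT+fU≤x̄ = subst₂ _≤_ (cong₂ _+_ T∈𝔉 U∈𝔉) refl (xbar-supermodular x opposite T U)
    x̄≤f⊓+f⊔ : xbar x (T ⊓ⁿ U) + xbar x (T ⊔ⁿ U) ≤ f (T ⊓ⁿ U) + f (T ⊔ⁿ U)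
    x̄≤f⊓+f⊔ = +-mono-≤ (x̄≤f (T ⊓ⁿ U)) (x̄≤f (T ⊔ⁿ U))
    x̄≡f : xbar x (T ⊓ⁿ U) + xbar x (T ⊔ⁿ U) ≡ f (T ⊓ⁿ U) + f (T ⊔ⁿ U)
    x̄≡f = ≤-antisym x̄≤f⊓+f⊔ (≤-trans (submodular T U) fT+fU≤x̄)
    f-modular : f (T ⊓ⁿ U) + f (T ⊔ⁿ U) ≡ f T + f U
    f-modular = ≤-antisym (submodular T U) (≤-trans fT+fU≤x̄ x̄≤f⊓+f⊔)

proposition4 : (G : OrderedAbelianGroup) → let open OAG G in
    (k n : ℕ) → 1 ℕ.≤ k → 1 ℕ.≤ n →
    (f : Tn k n → Carrier) → IsKSubmodular f → f 𝟎 ≡ 0# →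
    (x : Fin n → Fin k → Carrier) → InP f x →
    (∀ (T U : Tn k n) → In𝔉 f x T → In𝔉 f x U →
      In𝔉 f x (T ⊓ⁿ U) × In𝔉 f x (T ⊔ⁿ U)) ×
    (∀ (T U : Tn k n) → In𝔉 f x T → In𝔉 f x U →
      f (T ⊓ⁿ U) + f (T ⊔ⁿ U) ≡ f T + f U)
proposition4 G k n _ _ f submodular _ x x∈P =
  (λ T U T∈𝔉 U∈𝔉 → proj₁ (𝔉-closed-∧-modular f submodular x x∈P T U T∈𝔉 U∈𝔉)) ,
  (λ T U T∈𝔉 U∈𝔉 → proj₂ (𝔉-closed-∧-modular f submodular x x∈P T U T∈𝔉 U∈𝔉))
  where open FaceProperties G
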